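{- Over the class of transitive frames, $\frown\varphi,\smile\frown\varphi\models$ and $\models\frown\smile\varphi,\smile\varphi$.
   Context: Kripke models; $\mathcal{M},w\Vdash\smile\varphi$ iff $\varphi$ fails at some $R$-successor of $w$; $\mathcal{M},w\Vdash\frown\varphi$ iff $\varphi$ fails at every $R$-successor of $w$. A consecution $\Gamma\models\Delta$ holds over a class if at every world of every model on a frame of the class some member of $\Gamma$ fails or some member of $\Delta$ holds (empty sides allowed). -}

module Defs where

open import Data.Nat using (ℕ)
open import Data.Product using (Σ; _×_; _,_)
open import Data.Sum using (_⊎_)
open import Data.Empty using (⊥)
open import Data.Unit using (⊤)
open import Data.List using (List; []; _∷_)
open import Data.List.Relation.Unary.All using (All)
open import Relation.Nullary using (¬_)

data Fm : Set where
  var   : ℕ → Fm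
  ⊤'    : Fm
  ⊥'    : Fm
  ~_    : Fm → Fm
  _∧'_  : Fm → Fm → Fm
  _∨'_  : Fm → Fm → Fm
  _⇒'_  : Fm → Fm → Fm
  smile : Fm → Fm
  frown : Fm → Fm

record Frame : Set₁ where
  field
    W : Set
    R : W → W → Set

record Model : Set₁ where
  field
    frame : Frame
  open Frame frame public
  field
    V : ℕ → W → Set

Transitive : Frame → Set
Transitive F = ∀ {x y z} → R x y → R y z → R x z
  where open Frame F

_,_⊩_ : (M : Model) → Model.W M → Fm → Set
M , w ⊩ var p     = Model.V M p w
M , w ⊩ ⊤'        = ⊤
M , w ⊩ ⊥'        = ⊥
M , w ⊩ (~ φ)     = ¬ (M , w ⊩ φ)
M , w ⊩ (φ ∧' ψ)  = (M , w ⊩ φ) × (M , w ⊩ ψ)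
M , w ⊩ (φ ∨' ψ)  = (M , w ⊩ φ) ⊎ (M , w ⊩ ψ)
M , w ⊩ (φ ⇒' ψ)  = (M , w ⊩ φ) → (M , w ⊩ ψ)
M , w ⊩ smile φ   = Σ (Model.W M) λ v → Model.R M w v × ¬ (M , v ⊩ φ)
M , w ⊩ frown φ   = ∀ v → Model.R M w v → ¬ (M , v ⊩ φ)

-- A consecution Γ ⊨ Δ holds at w iff some member of Γ fails or some
-- member of Δ holds; read classically (as a negated conjunction):
-- it is impossible that all of Γ hold and all of Δ fail.
HoldsAt : (M : Model) → Model.W M → List Fm → List Fm → Set
HoldsAt M w Γ Δ = ¬ (All (λ φ → M , w ⊩ φ) Γ × All (λ φ → ¬ (M , w ⊩ φ)) Δ)

ValidOver : (Frame → Set) → List Fm → List Fm → Set₁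
ValidOver C Γ Δ = (M : Model) → C (Model.frame M) → (w : Model.W M) → HoldsAt M w Γ Δ

-- By transitivity, if ⌢φ holds at w it holds at every successor of w, which is
-- exactly the failure of ⌣⌢φ at w; and if ⌣φ fails at w, no successor of w sees
-- a φ-failure either, which is exactly ⌢⌣φ at w.
module Submission where

open import Defs
open import Data.Product using (_×_; _,_)
open import Data.List using ([]; _∷_)
open import Data.List.Relation.Unary.All using ([]; _∷_)
open import Relation.Nullary using (¬_)

module _ (M : Model) (trans : Transitive (Model.frame M)) where

  frown⇒¬smile-frown : ∀ {w} φ → M , w ⊩ frown φ → ¬ (M , w ⊩ smile (frown φ))
  frown⇒¬smile-frown φ ⌢φ (v , wRv , ¬⌢φ) = ¬⌢φ λ u vRu → ⌢φ u (trans wRv vRu)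

  ¬smile⇒frown-smile : ∀ {w} φ → ¬ (M , w ⊩ smile φ) → M , w ⊩ frown (smile φ)
  ¬smile⇒frown-smile φ ¬⌣φ v wRv (u , vRu , ¬φ) = ¬⌣φ (u , trans wRv vRu , ¬φ)

mainTheorem19 : (φ : Fm) →
    ValidOver Transitive (frown φ ∷ smile (frown φ) ∷ []) []
    × ValidOver Transitive [] (frown (smile φ) ∷ smile φ ∷ [])
mainTheorem19 φ = premisesInconsistent , conclusionsExhaustive
  where
  premisesInconsistent : ValidOver Transitive (frown φ ∷ smile (frown φ) ∷ []) []
  premisesInconsistent M trans w ((⌢φ ∷ ⌣⌢φ ∷ []) , []) =
    frown⇒¬smile-frown M trans φ ⌢φ ⌣⌢φ

  conclusionsExhaustive : ValidOver Transitive [] (frown (smile φ) ∷ smile φ ∷ [])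
  conclusionsExhaustive M trans w ([] , (¬⌢⌣φ ∷ ¬⌣φ ∷ [])) =
    ¬⌢⌣φ (¬smile⇒frown-smile M trans φ ¬⌣φ)
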